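{- Assume $F_P\neq\emptyset$ and $F_D\neq\emptyset$. The following are equivalent: (i) $v_P=v_D$; (ii) there exists a solution $x=(x_1,\dots,x_{n^2})^T$ of $(PP_{opt})$ with $x_i\neq\infty$ for $i=1,\dots,n^2$; (iii) there exists a solution $\lambda$ of $(DP_{opt})$ with $A_{eq}A_{\pi_1}^T\lambda=2g-(n+1)\mathbf{1}_k$.
   Context: Let $n\ge 2$ be an integer and $s(m)=\sum_{i=1}^{m-1} i$. Define matrices $A(m)$ with $s(m)$ rows and $m$ columns recursively: $A(1)$ is the empty matrix, and for $m\ge 2$, $A(m)=\begin{pmatrix}\mathbf{1}_{m-1} & -U_{m-1}\\ \mathbf{0}_{s(m-1)} & A(m-1)\end{pmatrix}$, where $\mathbf{1}_{m-1}$ is the column vector of ones, $U_{m-1}$ is the identity matrix and $\mathbf{0}_{s(m-1)}$ the zero column of length $s(m-1)$. Let $A$ be the $n\,s(n)\times n^2$ block-diagonal matrix with $n$ copies of $A(n)$ on its diagonal. For a permutation $\pi$ of $\{1,\dots,n^2\}$ let $A_\pi=(a^{\pi^{ -1}(1)},\dots,a^{\pi^{ -1}(n^2)})$, $a^j$ the $j$-th column of $A$. Fix permutations $\pi_1,\pi_2,\pi_3$ of $\{1,\dots,n^2\}$, $0\le k\le n^2$, an index set $\{i_1,\dots,i_k\}\subset\{1,\dots,n^2\}$, integers $g_{i_l}\in[1,n]$, $g=(g_{i_1},\dots,g_{i_k})^T$, and $A_{eq}$ the $k\times n^2$ matrix with $[A_{eq}x]_l=x_{i_l}$. $\mathbf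 1_k$ is the vector of $k$ ones. Let $\mathbb{Z}_\infty=\mathbb{Z}\cup\{\infty\}$, where $\infty$ is a formal token with $\infty+x=x+\infty=\infty+\infty=\infty$ for $x\in\mathbb{Z}$, $0\cdot\infty=\infty\cdot 0=0$, $x\cdot\infty=\infty\cdot x=\infty$ for $x\in\mathbb Z\setminus\{0\}$, and $\infty\ne x$ for every $x\in\mathbb{Z}$ (in particular $\infty\neq0$); matrix–vector products are extended using these rules. For a vector $y$, $y<>\mathbf{0}$ means every component of $y$ is different from $0$. $F_P=\{x\in\mathbb{Z}_\infty^{n^2}\mid$ for each $i$, $1\le x_i\le n$ or $x_i=\infty$; $A_{\pi_r}x<>\mathbf{0}$ for $r=1,2,3$; $A_{eq}x=g\}$, $f_P(x)=\sharp\{i\mid x_i=\infty\}$; $(PP_{opt})$: minimize $f_P$ over $F_P$, with optimal value $v_P=\min\{f_P(x)\mid x\in F_P\}$; $x$ solves $(PP_{opt})$ if $x\in F_P$ and $f_P(x)=v_P$. $F_D=\{\lambda\in\{ -1,+1\}^{n\cdot s(n)}\mid A_{\pi_r}A_{\pi_1}^T\lambda<>\mathbf{0}\text{ for }r=1,2,3\}$, $f_D(\lambda)=\sharp\{1\le l\le k\mid [A_{eq}A_{\pi_1}^T\lambda]_l=2g_{i_l}-(n+1)\}-k$; $(DP_{opt})$: maximize $f_D$ over $F_D$, with optimal value $v_D=\max\{f_D(\lambda)\mid \lambda\in F_D\}$; $\lambda$ solves $(DP_{opt})$ if $\lambda\in F_D$ and $f_D(\lambda)=v_D$. -}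

module Defs where

open import Data.Nat as ℕ using (ℕ; zero; suc)
open import Data.Integer as ℤ using (ℤ; +_; -_; _-_; 0ℤ; 1ℤ; -1ℤ)
open import Data.Fin as Fin using (Fin; splitAt; remQuot)
open import Data.Fin.Permutation using (Permutation′; _⟨$⟩ˡ_)
open import Data.Product using (_×_; _,_; ∃)
open import Data.Sum using (_⊎_; inj₁; inj₂)
open import Data.Bool using (Bool; true; false; if_then_else_)
open import Relation.Nullary using (¬_; does)
open import Relation.Binary.PropositionalEquality using (_≡_; _≢_)
open import Function using (_∘_; Injective)

-- Basic notation (indices are 0-based: Fin m stands for {1,…,m})

-- s(m) = Σ_{i=1}^{m-1} i   (s 0 = s 1 = 0, s (m+1) = m + s m)
s : ℕ → ℕ
s zero    = zero
s (suc m) = m ℕ.+ s m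

Mat : ℕ → ℕ → Set
Mat r c = Fin r → Fin c → ℤ

Vecℤ : ℕ → Set
Vecℤ m = Fin m → ℤ

sumℤ : ∀ {m} → (Fin m → ℤ) → ℤ
sumℤ {zero}  f = 0ℤ
sumℤ {suc m} f = f Fin.zero ℤ.+ sumℤ (f ∘ Fin.suc)

_ᵀ : ∀ {r c} → Mat r c → Mat c r
(M ᵀ) i j = M j i

_·ℤ_ : ∀ {r c} → Mat r c → Vecℤ c → Vecℤ r
(M ·ℤ v) i = sumℤ (λ j → M i j ℤ.* v j)

_⊗_ : ∀ {r m c} → Mat r m → Mat m c → Mat r c
(M ⊗ N) i j = sumℤ (λ l → M i l ℤ.* N l j)

data ℤ∞ : Set where
  fin : ℤ → ℤ∞
  ∞   : ℤ∞

_+∞_ : ℤ∞ → ℤ∞ → ℤ∞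
fin a +∞ fin b = fin (a ℤ.+ b)
fin a +∞ ∞     = ∞
∞     +∞ _     = ∞

-- integer scalar times element of ℤ∞:  0·∞ = 0, x·∞ = ∞ for x ≠ 0
_·∞_ : ℤ → ℤ∞ → ℤ∞
a ·∞ fin b = fin (a ℤ.* b)
a ·∞ ∞     = if does (a ℤ.≟ 0ℤ) then fin 0ℤ else ∞

sum∞ : ∀ {m} → (Fin m → ℤ∞) → ℤ∞
sum∞ {zero}  f = fin 0ℤ
sum∞ {suc m} f = f Fin.zero +∞ sum∞ (f ∘ Fin.suc)

_·∞v_ : ∀ {r c} → Mat r c → (Fin c → ℤ∞) → (Fin r → ℤ∞)
(M ·∞v x) i = sum∞ (λ j → M i j ·∞ x j)

_<>0 : ∀ {m} → (Fin m → ℤ∞) → Set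
y <>0 = ∀ i → y i ≢ fin 0ℤ

_<>0ℤ : ∀ {m} → (Fin m → ℤ) → Set
y <>0ℤ = ∀ i → y i ≢ 0ℤ

δ : ∀ {m} → Fin m → Fin m → ℤ
δ i j = if does (i Fin.≟ j) then 1ℤ else 0ℤ

-- A(m) : s(m) × m,  A(m+1) = ( 1_m  -U_m ; 0_{s(m)}  A(m) )
Am : (m : ℕ) → Mat (s m) m
Am zero    ()
Am (suc m) r c with splitAt m r | c
... | inj₁ i | Fin.zero  = 1ℤ
... | inj₁ i | Fin.suc j = - δ i j
... | inj₂ r′ | Fin.zero  = 0ℤ
... | inj₂ r′ | Fin.suc j = Am m r′ j

-- block-diagonal matrix with n copies of A(n): (n·s(n)) × n²
-- row (b, r) ↦ b·s(n)+r, column (b, c) ↦ b·n+c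
Ablk : (n : ℕ) → Mat (n ℕ.* s n) (n ℕ.* n)
Ablk n row col with remQuot {n} (s n) row | remQuot {n} n col
... | (b , r) | (b′ , c) = if does (b Fin.≟ b′) then Am n r c else 0ℤ

Aπ : (n : ℕ) → Permutation′ (n ℕ.* n) → Mat (n ℕ.* s n) (n ℕ.* n)
Aπ n π row j = Ablk n row (π ⟨$⟩ˡ j)

-- A_eq : k × n², [A_eq x]_l = x_{i_l}
Aeq : ∀ {k N} → (Fin k → Fin N) → Mat k N
Aeq idx l j = δ (idx l) j

count : ∀ {m} → (Fin m → Bool) → ℕ
count {zero}  p = zero
count {suc m} p = (if p Fin.zero then 1 else 0) ℕ.+ count (p ∘ Fin.suc)

isInf : ℤ∞ → Bool
isInf (fin _) = false
isInf ∞       = true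

module Problem (n : ℕ)
               (π₁ π₂ π₃ : Permutation′ (n ℕ.* n))
               (k : ℕ) (idx : Fin k → Fin (n ℕ.* n))
               (g : Fin k → ℤ) where

  N = n ℕ.* n

  Ar : Fin 3 → Mat (n ℕ.* s n) N
  Ar Fin.zero                     = Aπ n π₁
  Ar (Fin.suc Fin.zero)           = Aπ n π₂
  Ar (Fin.suc (Fin.suc Fin.zero)) = Aπ n π₃

  InFP : (Fin N → ℤ∞) → Set
  InFP x = (∀ i → (∃ λ z → x i ≡ fin z × + 1 ℤ.≤ z × z ℤ.≤ + n) ⊎ x i ≡ ∞)
         × (∀ r → (Ar r ·∞v x) <>0)
         × (∀ l → (Aeq idx ·∞v x) l ≡ fin (g l))

  fP : (Fin N → ℤ∞) → ℕ
  fP x = count (λ i → isInf (x i))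

  IsVP : ℕ → Set
  IsVP v = (∃ λ x → InFP x × fP x ≡ v) × (∀ x → InFP x → v ℕ.≤ fP x)

  SolvesPP : ℕ → (Fin N → ℤ∞) → Set
  SolvesPP vP x = InFP x × fP x ≡ vP

  eqDual : Vecℤ (n ℕ.* s n) → Vecℤ k
  eqDual λ′ = (Aeq idx ⊗ (Aπ n π₁ ᵀ)) ·ℤ λ′

  rhs : Fin k → ℤ
  rhs l = + 2 ℤ.* g l - + (suc n)

  InFD : Vecℤ (n ℕ.* s n) → Set
  InFD λ′ = (∀ j → λ′ j ≡ -1ℤ ⊎ λ′ j ≡ 1ℤ)
          × (∀ r → ((Ar r ⊗ (Aπ n π₁ ᵀ)) ·ℤ λ′) <>0ℤ)

  fD : Vecℤ (n ℕ.* s n) → ℤ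
  fD λ′ = + count (λ l → does (eqDual λ′ l ℤ.≟ rhs l)) - + k

  IsVD : ℤ → Set
  IsVD v = (∃ λ λ′ → InFD λ′ × fD λ′ ≡ v) × (∀ λ′ → InFD λ′ → fD λ′ ℤ.≤ v)

  SolvesDP : ℤ → Vecℤ (n ℕ.* s n) → Set
  SolvesDP vD λ′ = InFD λ′ × fD λ′ ≡ vD

-- Every row of A(n) has one entry 1 and one entry −1, so A_π 𝟏 = 0. Hence if
-- A_{π₁}ᵀ λ = 2x − (n + 1)𝟏 then A_{π_r} A_{π₁}ᵀ λ = 2 A_{π_r} x and
-- A_eq A_{π₁}ᵀ λ = 2 A_eq x − (n + 1)𝟏, so λ is dual feasible and meets all k equations
-- exactly when x is an ∞-free primal feasible point. Such pairs exist in both directions.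
-- For λ ∈ {±1}ˢ every entry of A(n)ᵀ λ is a sum of n − 1 signs, hence of the form
-- 2t − (n + 1) with 1 ≤ t ≤ n. Conversely A_{π₁} x <> 0 makes x injective on each block,
-- i.e. a permutation of 1, …, n there, and putting the sign of x_i − x_j on the row
-- x_i − x_j gives A(n)ᵀ λ = 2x − (n + 1)𝟏. Since f_P ≥ 0, with equality iff x is ∞-free,
-- and f_D ≤ 0, with equality iff all k equations hold, each of (i)–(iii) amounts to
-- v_P = 0 = v_D.
module Submission where

open import Defs
open import Data.Nat using (ℕ; _≤_)
open import Data.Integer using (ℤ; +_)
open import Data.Fin using (Fin)
open import Data.Fin.Permutation using (Permutation′)
open import Data.Product using (_×_; ∃)
open import Relation.Nullary using (¬_)
open import Relation.Binary.PropositionalEquality using (_≡_; _≢_)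
open import Function using (Injective; _⇔_)

import Algebra.Properties.Semiring.Sum
import Algebra.Properties.Group
open import Algebra.Bundles using (AbelianGroup)
open import Data.Bool using (Bool; true; false; if_then_else_)
open import Data.Empty using (⊥-elim)
open import Data.Fin as Fin using (zero; suc; _↑ˡ_; _↑ʳ_; combine; remQuot; splitAt; toℕ)
import Data.Fin.Properties as Finₚ
open import Data.Fin.Permutation as Perm using (_⟨$⟩ʳ_; _⟨$⟩ˡ_)
import Data.Nat as ℕ
import Data.Nat.Properties as ℕₚ
open import Data.Integer as ℤ using (_+_; _*_; _-_; -_; 0ℤ; 1ℤ; -1ℤ)
import Data.Integer.Properties as ℤₚ
open import Data.Integer.Tactic.RingSolver using (solve-∀)
open import Data.Product using (_,_; proj₁; proj₂; swap)
open import Data.Sum using (_⊎_; inj₁; inj₂)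
open import Function using (_∘_)
open import Function.Bundles using (Equivalence; mk⇔)
open import Relation.Binary.PropositionalEquality
  using (refl; sym; trans; cong; cong₂; subst; _≗_; module ≡-Reasoning)
open import Relation.Nullary using (does; yes; no)
open import Relation.Nullary.Decidable using (dec-true)

module Σℤ = Algebra.Properties.Semiring.Sum ℤₚ.+-*-semiring
open Algebra.Properties.Group (AbelianGroup.group ℤₚ.+-0-abelianGroup)
  using () renaming (∙-cancelʳ to +-cancelʳ)

sumℤ≡sum : ∀ {m} (f : Fin m → ℤ) → sumℤ f ≡ Σℤ.sum f
sumℤ≡sum {ℕ.zero}  f = refl
sumℤ≡sum {ℕ.suc m} f = cong (λ t → f zero + t) (sumℤ≡sum (f ∘ suc))

sumℤ-cong : ∀ {m} {f h : Fin m → ℤ} → f ≗ h → sumℤ f ≡ sumℤ h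
sumℤ-cong {f = f} {h} f≗h =
  trans (sumℤ≡sum f) (trans (Σℤ.sum-cong-≗ f≗h) (sym (sumℤ≡sum h)))

sumℤ-zero : ∀ m → sumℤ {m} (λ _ → 0ℤ) ≡ 0ℤ
sumℤ-zero m = trans (sumℤ≡sum {m} (λ _ → 0ℤ)) (Σℤ.sum-replicate-zero m)

sumℤ-distrib-+ : ∀ {m} (f h : Fin m → ℤ) → sumℤ (λ i → f i + h i) ≡ sumℤ f + sumℤ h
sumℤ-distrib-+ f h = begin
  sumℤ (λ i → f i + h i)     ≡⟨ sumℤ≡sum (λ i → f i + h i) ⟩
  Σℤ.sum (λ i → f i + h i)   ≡⟨ Σℤ.∑-distrib-+ f h ⟩
  Σℤ.sum f + Σℤ.sum h        ≡⟨ sym (cong₂ _+_ (sumℤ≡sum f) (sumℤ≡sum h)) ⟩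
  sumℤ f + sumℤ h            ∎
  where open ≡-Reasoning

*-distribˡ-sumℤ : ∀ {m} a (f : Fin m → ℤ) → a * sumℤ f ≡ sumℤ (λ i → a * f i)
*-distribˡ-sumℤ a f = begin
  a * sumℤ f                 ≡⟨ cong (λ t → a * t) (sumℤ≡sum f) ⟩
  a * Σℤ.sum f               ≡⟨ Σℤ.*-distribˡ-sum a f ⟩
  Σℤ.sum (λ i → a * f i)     ≡⟨ sym (sumℤ≡sum (λ i → a * f i)) ⟩
  sumℤ (λ i → a * f i)       ∎
  where open ≡-Reasoning

*-distribʳ-sumℤ : ∀ {m} a (f : Fin m → ℤ) → sumℤ f * a ≡ sumℤ (λ i → f i * a)
*-distribʳ-sumℤ a f = begin
  sumℤ f * a                 ≡⟨ ℤₚ.*-comm (sumℤ f) a ⟩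
  a * sumℤ f                 ≡⟨ *-distribˡ-sumℤ a f ⟩
  sumℤ (λ i → a * f i)       ≡⟨ sumℤ-cong (λ i → ℤₚ.*-comm a (f i)) ⟩
  sumℤ (λ i → f i * a)       ∎
  where open ≡-Reasoning

sumℤ-comm : ∀ {m k} (f : Fin m → Fin k → ℤ) →
  sumℤ (λ i → sumℤ (f i)) ≡ sumℤ (λ j → sumℤ (λ i → f i j))
sumℤ-comm f = begin
  sumℤ (λ i → sumℤ (f i))               ≡⟨ sumℤ-cong (λ i → sumℤ≡sum (f i)) ⟩
  sumℤ (λ i → Σℤ.sum (f i))             ≡⟨ sumℤ≡sum (λ i → Σℤ.sum (f i)) ⟩
  Σℤ.sum (λ i → Σℤ.sum (f i))           ≡⟨ Σℤ.∑-comm f ⟩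
  Σℤ.sum (λ j → Σℤ.sum (λ i → f i j))   ≡⟨ sym (sumℤ≡sum (λ j → Σℤ.sum (λ i → f i j))) ⟩
  sumℤ (λ j → Σℤ.sum (λ i → f i j))     ≡⟨ sumℤ-cong (λ j → sym (sumℤ≡sum (λ i → f i j))) ⟩
  sumℤ (λ j → sumℤ (λ i → f i j))       ∎
  where open ≡-Reasoning

sumℤ-permute : ∀ {m} (f : Fin m → ℤ) (π : Permutation′ m) → sumℤ f ≡ sumℤ (f ∘ (π ⟨$⟩ʳ_))
sumℤ-permute f π =
  trans (sumℤ≡sum f) (trans (Σℤ.sum-permute f π) (sym (sumℤ≡sum (f ∘ (π ⟨$⟩ʳ_)))))

sumℤ-↑ : ∀ m {k} (f : Fin (m ℕ.+ k) → ℤ) →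
  sumℤ f ≡ sumℤ (λ i → f (i ↑ˡ k)) + sumℤ (λ j → f (m ↑ʳ j))
sumℤ-↑ ℕ.zero    f = sym (ℤₚ.+-identityˡ _)
sumℤ-↑ (ℕ.suc m) f =
  trans (cong (λ t → f zero + t) (sumℤ-↑ m (f ∘ suc))) (sym (ℤₚ.+-assoc (f zero) _ _))

sumℤ-combine : ∀ m {k} (f : Fin (m ℕ.* k) → ℤ) →
  sumℤ f ≡ sumℤ (λ (b : Fin m) → sumℤ (λ (r : Fin k) → f (combine b r)))
sumℤ-combine ℕ.zero    f = refl
sumℤ-combine (ℕ.suc m) {k} f =
  trans (sumℤ-↑ k f)
        (cong (λ t → sumℤ (λ r → f (combine {ℕ.suc m} zero r)) + t) (sumℤ-combine m (f ∘ (k ↑ʳ_))))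

sumℤ-if-≟ : ∀ {m} (i : Fin m) (h : Fin m → ℤ) →
  sumℤ (λ j → if does (i Fin.≟ j) then h j else 0ℤ) ≡ h i
sumℤ-if-≟ {ℕ.suc m} zero    h = trans (cong (λ t → h zero + t) (sumℤ-zero m)) (ℤₚ.+-identityʳ _)
sumℤ-if-≟ {ℕ.suc m} (suc i) h = trans (ℤₚ.+-identityˡ _) (sumℤ-if-≟ i (h ∘ suc))

δ-* : ∀ {m} (i j : Fin m) v → δ i j * v ≡ (if does (i Fin.≟ j) then v else 0ℤ)
δ-* i j v with does (i Fin.≟ j)
... | true  = ℤₚ.*-identityˡ v
... | false = ℤₚ.*-zeroˡ v

sumℤ-δ : ∀ {m} (i : Fin m) (v : Fin m → ℤ) → sumℤ (λ j → δ i j * v j) ≡ v i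
sumℤ-δ i v = trans (sumℤ-cong (λ j → δ-* i j (v j))) (sumℤ-if-≟ i v)

⊗-·ℤ-assoc : ∀ {r m c} (M : Mat r m) (Q : Mat m c) (v : Vecℤ c) → (M ⊗ Q) ·ℤ v ≗ M ·ℤ (Q ·ℤ v)
⊗-·ℤ-assoc M Q v i = begin
  sumℤ (λ j → sumℤ (λ l → M i l * Q l j) * v j)
    ≡⟨ sumℤ-cong (λ j → *-distribʳ-sumℤ (v j) (λ l → M i l * Q l j)) ⟩
  sumℤ (λ j → sumℤ (λ l → M i l * Q l j * v j))
    ≡⟨ sumℤ-comm (λ j l → M i l * Q l j * v j) ⟩
  sumℤ (λ l → sumℤ (λ j → M i l * Q l j * v j))
    ≡⟨ sumℤ-cong (λ l → sumℤ-cong (λ j → ℤₚ.*-assoc (M i l) (Q l j) (v j))) ⟩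
  sumℤ (λ l → sumℤ (λ j → M i l * (Q l j * v j)))
    ≡⟨ sumℤ-cong (λ l → sym (*-distribˡ-sumℤ (M i l) (λ j → Q l j * v j))) ⟩
  sumℤ (λ l → M i l * sumℤ (λ j → Q l j * v j)) ∎
  where open ≡-Reasoning

·ℤ-congʳ : ∀ {r c} (M : Mat r c) {v w : Vecℤ c} → v ≗ w → M ·ℤ v ≗ M ·ℤ w
·ℤ-congʳ M v≗w i = sumℤ-cong (λ j → cong (M i j *_) (v≗w j))

·ℤ-affine-balanced : ∀ {r c} (M : Mat r c) (a b : ℤ) (x : Vecℤ c) i →
  (M ·ℤ (λ _ → 1ℤ)) i ≡ 0ℤ → (M ·ℤ (λ j → a * x j - b)) i ≡ a * (M ·ℤ x) i
·ℤ-affine-balanced M a b x i balanced = begin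
  sumℤ (λ j → M i j * (a * x j - b))
    ≡⟨ sumℤ-cong (λ j → expand (M i j) (x j) a b) ⟩
  sumℤ (λ j → a * (M i j * x j) + (- b) * (M i j * 1ℤ))
    ≡⟨ sumℤ-distrib-+ (λ j → a * (M i j * x j)) (λ j → (- b) * (M i j * 1ℤ)) ⟩
  sumℤ (λ j → a * (M i j * x j)) + sumℤ (λ j → (- b) * (M i j * 1ℤ))
    ≡⟨ sym (cong₂ _+_ (*-distribˡ-sumℤ a (λ j → M i j * x j))
                      (*-distribˡ-sumℤ (- b) (λ j → M i j * 1ℤ))) ⟩
  a * (M ·ℤ x) i + (- b) * (M ·ℤ (λ _ → 1ℤ)) i
    ≡⟨ cong (λ t → a * (M ·ℤ x) i + (- b) * t) balanced ⟩
  a * (M ·ℤ x) i + (- b) * 0ℤ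
    ≡⟨ drop (a * (M ·ℤ x) i) (- b) ⟩
  a * (M ·ℤ x) i ∎
  where
  open ≡-Reasoning
  expand : ∀ m y a b → m * (a * y - b) ≡ a * (m * y) + (- b) * (m * 1ℤ)
  expand = solve-∀
  drop : ∀ u v → u + v * 0ℤ ≡ u
  drop = solve-∀

≟-sym : ∀ {m} (i j : Fin m) → does (i Fin.≟ j) ≡ does (j Fin.≟ i)
≟-sym i j with i Fin.≟ j | j Fin.≟ i
... | yes _   | yes _   = refl
... | no _    | no _    = refl
... | yes i≡j | no j≢i  = ⊥-elim (j≢i (sym i≡j))
... | no i≢j  | yes j≡i = ⊥-elim (i≢j (sym j≡i))

sumℤ-negδ : ∀ {m} (i : Fin m) (w : Fin m → ℤ) → sumℤ (λ j → (- δ i j) * w j) ≡ - w i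
sumℤ-negδ i w = begin
  sumℤ (λ j → (- δ i j) * w j)     ≡⟨ sumℤ-cong (λ j → sym (ℤₚ.neg-distribˡ-* (δ i j) (w j))) ⟩
  sumℤ (λ j → - (δ i j * w j))     ≡⟨ sumℤ-cong (λ j → sym (ℤₚ.-1*i≡-i (δ i j * w j))) ⟩
  sumℤ (λ j → -1ℤ * (δ i j * w j)) ≡⟨ sym (*-distribˡ-sumℤ -1ℤ (λ j → δ i j * w j)) ⟩
  -1ℤ * sumℤ (λ j → δ i j * w j)   ≡⟨ cong (λ t → -1ℤ * t) (sumℤ-δ i w) ⟩
  -1ℤ * w i                        ≡⟨ ℤₚ.-1*i≡-i (w i) ⟩
  - w i                            ∎
  where open ≡-Reasoning

sumℤ-negδᵀ : ∀ {m} (j : Fin m) (w : Fin m → ℤ) → sumℤ (λ i → (- δ i j) * w i) ≡ - w j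
sumℤ-negδᵀ j w =
  trans (sumℤ-cong (λ i → cong (λ d → (- (if d then 1ℤ else 0ℤ)) * w i) (≟-sym i j))) (sumℤ-negδ j w)

-- The matrices A(m)

↑-elim : ∀ m {k} (P : Fin (m ℕ.+ k) → Set) →
  (∀ i → P (i ↑ˡ k)) → (∀ j → P (m ↑ʳ j)) → ∀ r → P r
↑-elim m P left right r with splitAt m r in eq
... | inj₁ i = subst P (Finₚ.splitAt⁻¹-↑ˡ eq) (left i)
... | inj₂ j = subst P (Finₚ.splitAt⁻¹-↑ʳ eq) (right j)

module _ (m : ℕ) where

  Am-↑ˡ-zero : ∀ i → Am (ℕ.suc m) (i ↑ˡ s m) zero ≡ 1ℤ
  Am-↑ˡ-zero i rewrite Finₚ.splitAt-↑ˡ m i (s m) = refl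

  Am-↑ˡ-suc : ∀ i j → Am (ℕ.suc m) (i ↑ˡ s m) (suc j) ≡ - δ i j
  Am-↑ˡ-suc i j rewrite Finₚ.splitAt-↑ˡ m i (s m) = refl

  Am-↑ʳ-zero : ∀ r → Am (ℕ.suc m) (m ↑ʳ r) zero ≡ 0ℤ
  Am-↑ʳ-zero r rewrite Finₚ.splitAt-↑ʳ m (s m) r = refl

  Am-↑ʳ-suc : ∀ r j → Am (ℕ.suc m) (m ↑ʳ r) (suc j) ≡ Am m r j
  Am-↑ʳ-suc r j rewrite Finₚ.splitAt-↑ʳ m (s m) r = refl

  Am-·ℤ-↑ˡ : ∀ (v : Vecℤ (ℕ.suc m)) i → (Am (ℕ.suc m) ·ℤ v) (i ↑ˡ s m) ≡ v zero - v (suc i)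
  Am-·ℤ-↑ˡ v i = cong₂ _+_
    (trans (cong (_* v zero) (Am-↑ˡ-zero i)) (ℤₚ.*-identityˡ (v zero)))
    (trans (sumℤ-cong (λ j → cong (_* v (suc j)) (Am-↑ˡ-suc i j))) (sumℤ-negδ i (v ∘ suc)))

  Am-·ℤ-↑ʳ : ∀ (v : Vecℤ (ℕ.suc m)) r →
    (Am (ℕ.suc m) ·ℤ v) (m ↑ʳ r) ≡ (Am m ·ℤ (v ∘ suc)) r
  Am-·ℤ-↑ʳ v r = trans
    (cong₂ _+_ (trans (cong (_* v zero) (Am-↑ʳ-zero r)) (ℤₚ.*-zeroˡ (v zero)))
               (sumℤ-cong (λ j → cong (_* v (suc j)) (Am-↑ʳ-suc r j))))
    (ℤₚ.+-identityˡ _)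

  Amᵀ-·ℤ-zero : ∀ (l : Vecℤ (s (ℕ.suc m))) →
    ((Am (ℕ.suc m) ᵀ) ·ℤ l) zero ≡ sumℤ (λ i → l (i ↑ˡ s m))
  Amᵀ-·ℤ-zero l = begin
    ((Am (ℕ.suc m) ᵀ) ·ℤ l) zero
      ≡⟨ sumℤ-↑ m (λ r → Am (ℕ.suc m) r zero * l r) ⟩
    sumℤ (λ i → Am (ℕ.suc m) (i ↑ˡ s m) zero * l (i ↑ˡ s m))
      + sumℤ (λ r → Am (ℕ.suc m) (m ↑ʳ r) zero * l (m ↑ʳ r))
      ≡⟨ cong₂ _+_
           (sumℤ-cong (λ i → trans (cong (_* l (i ↑ˡ s m)) (Am-↑ˡ-zero i)) (ℤₚ.*-identityˡ _)))
           (sumℤ-cong (λ r → trans (cong (_* l (m ↑ʳ r)) (Am-↑ʳ-zero r)) (ℤₚ.*-zeroˡ (l (m ↑ʳ r))))) ⟩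
    sumℤ (λ i → l (i ↑ˡ s m)) + sumℤ {s m} (λ _ → 0ℤ)
      ≡⟨ cong (λ t → sumℤ (λ i → l (i ↑ˡ s m)) + t) (sumℤ-zero (s m)) ⟩
    sumℤ (λ i → l (i ↑ˡ s m)) + 0ℤ
      ≡⟨ ℤₚ.+-identityʳ _ ⟩
    sumℤ (λ i → l (i ↑ˡ s m)) ∎
    where open ≡-Reasoning

  Amᵀ-·ℤ-suc : ∀ (l : Vecℤ (s (ℕ.suc m))) j →
    ((Am (ℕ.suc m) ᵀ) ·ℤ l) (suc j) ≡ - l (j ↑ˡ s m) + ((Am m ᵀ) ·ℤ (l ∘ (m ↑ʳ_))) j
  Amᵀ-·ℤ-suc l j = trans (sumℤ-↑ m (λ r → Am (ℕ.suc m) r (suc j) * l r)) (cong₂ _+_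
    (trans (sumℤ-cong (λ i → cong (_* l (i ↑ˡ s m)) (Am-↑ˡ-suc i j)))
           (sumℤ-negδᵀ j (l ∘ (_↑ˡ s m))))
    (sumℤ-cong (λ r → cong (_* l (m ↑ʳ r)) (Am-↑ʳ-suc r j))))

Am-·ℤ-const : ∀ m (a : ℤ) r → (Am m ·ℤ (λ _ → a)) r ≡ 0ℤ
Am-·ℤ-const (ℕ.suc m) a = ↑-elim m (λ r → (Am (ℕ.suc m) ·ℤ (λ _ → a)) r ≡ 0ℤ)
  (λ i → trans (Am-·ℤ-↑ˡ m (λ _ → a) i) (ℤₚ.+-inverseʳ a))
  (λ r → trans (Am-·ℤ-↑ʳ m (λ _ → a) r) (Am-·ℤ-const m a r))

-- The rows of A(m) are the differences v i − v j for i < j.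
Am-·ℤ-nonzero⇒injective : ∀ m (v : Vecℤ m) → (Am m ·ℤ v) <>0ℤ → Injective _≡_ _≡_ v
Am-·ℤ-nonzero⇒injective (ℕ.suc m) v nonzero {zero}  {zero}  _ = refl
Am-·ℤ-nonzero⇒injective (ℕ.suc m) v nonzero {zero}  {suc j} v₀≡vⱼ = ⊥-elim (nonzero (j ↑ˡ s m)
  (trans (Am-·ℤ-↑ˡ m v j) (trans (cong (_- v (suc j)) v₀≡vⱼ) (ℤₚ.+-inverseʳ (v (suc j))))))
Am-·ℤ-nonzero⇒injective (ℕ.suc m) v nonzero {suc i} {zero}  vᵢ≡v₀ = ⊥-elim (nonzero (i ↑ˡ s m)
  (trans (Am-·ℤ-↑ˡ m v i) (trans (cong (_- v (suc i)) (sym vᵢ≡v₀)) (ℤₚ.+-inverseʳ (v (suc i))))))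
Am-·ℤ-nonzero⇒injective (ℕ.suc m) v nonzero {suc i} {suc j} vᵢ≡vⱼ = cong suc
  (Am-·ℤ-nonzero⇒injective m (v ∘ suc) (λ r → nonzero (m ↑ʳ r) ∘ trans (Am-·ℤ-↑ʳ m v r))
                           vᵢ≡vⱼ)

Sign : ℤ → Set
Sign z = z ≡ -1ℤ ⊎ z ≡ 1ℤ

rank : ∀ {m} → Fin m → ℤ
rank c = + ℕ.suc (toℕ c)

sumℤ-signs : ∀ m (f : Vecℤ m) → (∀ i → Sign (f i)) →
  ∃ λ t → ∃ λ u → t ℕ.+ u ≡ m × sumℤ f ≡ + t - + u
sumℤ-signs ℕ.zero    f signs = 0 , 0 , refl , refl
sumℤ-signs (ℕ.suc m) f signs with sumℤ-signs m (f ∘ suc) (signs ∘ suc) | signs zero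
... | t , u , t+u≡m , sum≡ | inj₁ f₀≡-1 =
  t , ℕ.suc u , trans (ℕₚ.+-suc t u) (cong ℕ.suc t+u≡m) ,
  trans (cong₂ _+_ f₀≡-1 sum≡) (add-1 (+ t) (+ u))
  where add-1 : ∀ a b → -1ℤ + (a - b) ≡ a - (1ℤ + b)
        add-1 = solve-∀
... | t , u , t+u≡m , sum≡ | inj₂ f₀≡1 =
  ℕ.suc t , u , cong ℕ.suc t+u≡m , trans (cong₂ _+_ f₀≡1 sum≡) (add1 (+ t) (+ u))
  where add1 : ∀ a b → 1ℤ + (a - b) ≡ (1ℤ + a) - b
        add1 = solve-∀

Amᵀ-·ℤ-signs-balance : ∀ m (l : Vecℤ (s (ℕ.suc m))) → (∀ r → Sign (l r)) → ∀ c →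
  ∃ λ t → ∃ λ u → t ℕ.+ u ≡ m × ((Am (ℕ.suc m) ᵀ) ·ℤ l) c ≡ + t - + u
Amᵀ-·ℤ-signs-balance m l signs zero with sumℤ-signs m (l ∘ (_↑ˡ s m)) (signs ∘ (_↑ˡ s m))
... | t , u , t+u≡m , sum≡ = t , u , t+u≡m , trans (Amᵀ-·ℤ-zero m l) sum≡
Amᵀ-·ℤ-signs-balance (ℕ.suc m) l signs (suc j)
  with Amᵀ-·ℤ-signs-balance m (l ∘ (ℕ.suc m ↑ʳ_)) (signs ∘ (ℕ.suc m ↑ʳ_)) j
     | signs (j ↑ˡ s (ℕ.suc m))
... | t , u , t+u≡m , col≡ | inj₁ lⱼ≡-1 =
  ℕ.suc t , u , cong ℕ.suc t+u≡m ,
  trans (Amᵀ-·ℤ-suc (ℕ.suc m) l j) (trans (cong₂ _+_ (cong -_ lⱼ≡-1) col≡) (add1 (+ t) (+ u)))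
  where add1 : ∀ a b → - -1ℤ + (a - b) ≡ (1ℤ + a) - b
        add1 = solve-∀
... | t , u , t+u≡m , col≡ | inj₂ lⱼ≡1 =
  t , ℕ.suc u , trans (ℕₚ.+-suc t u) (cong ℕ.suc t+u≡m) ,
  trans (Amᵀ-·ℤ-suc (ℕ.suc m) l j) (trans (cong₂ _+_ (cong -_ lⱼ≡1) col≡) (add-1 (+ t) (+ u)))
  where add-1 : ∀ a b → - 1ℤ + (a - b) ≡ a - (1ℤ + b)
        add-1 = solve-∀

-- A column of A(m) has m − 1 entries ±1, so on a sign vector it is t − u with t + u = m − 1,
-- that is 2(t + 1) − (m + 1).
Amᵀ-·ℤ-signs : ∀ m (l : Vecℤ (s m)) → (∀ r → Sign (l r)) → ∀ (c : Fin m) →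
  ∃ λ (t : Fin m) → ((Am m ᵀ) ·ℤ l) c ≡ + 2 * rank t - + ℕ.suc m
Amᵀ-·ℤ-signs (ℕ.suc m) l signs c with Amᵀ-·ℤ-signs-balance m l signs c
... | t , u , refl , col≡ = Fin.fromℕ< t<1+t+u , trans col≡ (trans (balance (+ t) (+ u))
  (cong (λ a → + 2 * + ℕ.suc a - + ℕ.suc (ℕ.suc (t ℕ.+ u))) (sym (Finₚ.toℕ-fromℕ< t<1+t+u))))
  where
  t<1+t+u : t ℕ.< ℕ.suc (t ℕ.+ u)
  t<1+t+u = ℕ.s≤s (ℕₚ.m≤m+n t u)
  balance : ∀ a b → a - b ≡ + 2 * (1ℤ + a) - (1ℤ + (1ℤ + (a + b)))
  balance = solve-∀

sgn : ℕ → ℕ → ℤ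
sgn ℕ.zero    ℕ.zero    = 0ℤ
sgn ℕ.zero    (ℕ.suc _) = -1ℤ
sgn (ℕ.suc _) ℕ.zero    = 1ℤ
sgn (ℕ.suc a) (ℕ.suc b) = sgn a b

sgn-refl : ∀ a → sgn a a ≡ 0ℤ
sgn-refl ℕ.zero    = refl
sgn-refl (ℕ.suc a) = sgn-refl a

neg-sgn : ∀ a b → - sgn a b ≡ sgn b a
neg-sgn ℕ.zero    ℕ.zero    = refl
neg-sgn ℕ.zero    (ℕ.suc b) = refl
neg-sgn (ℕ.suc a) ℕ.zero    = refl
neg-sgn (ℕ.suc a) (ℕ.suc b) = neg-sgn a b

sgn-sign : ∀ a b → a ≢ b → Sign (sgn a b)
sgn-sign ℕ.zero    ℕ.zero    a≢b = ⊥-elim (a≢b refl)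
sgn-sign ℕ.zero    (ℕ.suc b) a≢b = inj₁ refl
sgn-sign (ℕ.suc a) ℕ.zero    a≢b = inj₂ refl
sgn-sign (ℕ.suc a) (ℕ.suc b) a≢b = sgn-sign a b (a≢b ∘ cong ℕ.suc)

sumℤ-sgn-toℕ : ∀ m a → a ℕ.< m → sumℤ {m} (λ u → sgn a (toℕ u)) ≡ + 2 * + ℕ.suc a - + ℕ.suc m
sumℤ-sgn-toℕ (ℕ.suc m) ℕ.zero    _ =
  trans (ℤₚ.+-identityˡ _) (trans (all-below m) (rearrange (+ m)))
  where
  all-below : ∀ m → sumℤ {m} (λ u → sgn 0 (toℕ (suc u))) ≡ - + m
  all-below ℕ.zero    = refl
  all-below (ℕ.suc m) = trans (cong (λ t → -1ℤ + t) (all-below m)) (sym (ℤₚ.neg-distrib-+ 1ℤ (+ m)))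
  rearrange : ∀ a → - a ≡ + 2 * 1ℤ - (1ℤ + (1ℤ + a))
  rearrange = solve-∀
sumℤ-sgn-toℕ (ℕ.suc m) (ℕ.suc a) (ℕ.s≤s a<m) =
  trans (cong (λ t → 1ℤ + t) (sumℤ-sgn-toℕ m a a<m)) (step (+ a) (+ m))
  where step : ∀ a m → 1ℤ + (+ 2 * (1ℤ + a) - (1ℤ + m)) ≡ + 2 * (1ℤ + (1ℤ + a)) - (1ℤ + (1ℤ + m))
        step = solve-∀

injective⇒surjective : ∀ {m} (f : Fin m → Fin m) → Injective _≡_ _≡_ f →
  ∀ v → ∃ λ c → f c ≡ v
injective⇒surjective {ℕ.zero}  f f-inj ()
injective⇒surjective {ℕ.suc m} f f-inj v with Finₚ.any? (λ c → f c Fin.≟ v)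
... | yes hit = hit
... | no miss = ⊥-elim (Finₚ.<⇒notInjective {f = λ c → Fin.punchOut (v≢f c)} (ℕₚ.n<1+n m)
                          (λ e → f-inj (Finₚ.punchOut-injective (v≢f _) (v≢f _) e)))
  where
  v≢f : ∀ c → v ≢ f c
  v≢f c v≡fc = miss (c , sym v≡fc)

sumℤ-reindex : ∀ {m} (f : Fin m → Fin m) → Injective _≡_ _≡_ f →
  (h : Vecℤ m) → sumℤ (h ∘ f) ≡ sumℤ h
sumℤ-reindex {m} f f-inj h = sym (sumℤ-permute h π)
  where
  surjective : ∀ v → ∃ λ c → f c ≡ v
  surjective = injective⇒surjective f f-inj

  π : Permutation′ m
  π = Perm.permutation f (proj₁ ∘ surjective) (proj₂ ∘ surjective) (λ c → f-inj (proj₂ (surjective (f c))))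

-- Exactly toℕ (w c) values of w lie below w c and m − 1 − toℕ (w c) above it.
sumℤ-sgn-permutation : ∀ {m} (w : Fin m → Fin m) → Injective _≡_ _≡_ w → ∀ c →
  sumℤ (λ c′ → sgn (toℕ (w c)) (toℕ (w c′))) ≡ + 2 * rank (w c) - + ℕ.suc m
sumℤ-sgn-permutation {m} w w-inj c =
  trans (sumℤ-reindex w w-inj (λ u → sgn (toℕ (w c)) (toℕ u)))
        (sumℤ-sgn-toℕ m (toℕ (w c)) (Finₚ.toℕ<n (w c)))

-- The entry for the row v i − v j of A(m) is the sign of w i − w j.
signPattern : ∀ m → (Fin m → ℕ) → Vecℤ (s m)
signPattern (ℕ.suc m) w r with splitAt m r
... | inj₁ i = sgn (w zero) (w (suc i))
... | inj₂ r = signPattern m (w ∘ suc) r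

module _ (m : ℕ) (w : Fin (ℕ.suc m) → ℕ) where

  signPattern-↑ˡ : ∀ i → signPattern (ℕ.suc m) w (i ↑ˡ s m) ≡ sgn (w zero) (w (suc i))
  signPattern-↑ˡ i rewrite Finₚ.splitAt-↑ˡ m i (s m) = refl

  signPattern-↑ʳ : ∀ r → signPattern (ℕ.suc m) w (m ↑ʳ r) ≡ signPattern m (w ∘ suc) r
  signPattern-↑ʳ r rewrite Finₚ.splitAt-↑ʳ m (s m) r = refl

signPattern-sign : ∀ m (w : Fin m → ℕ) → Injective _≡_ _≡_ w → ∀ r → Sign (signPattern m w r)
signPattern-sign (ℕ.suc m) w w-inj = ↑-elim m (Sign ∘ signPattern (ℕ.suc m) w)
  (λ i → subst Sign (sym (signPattern-↑ˡ m w i))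
           (sgn-sign _ _ (λ w₀≡wᵢ → zero≢suc (w-inj w₀≡wᵢ))))
  (λ r → subst Sign (sym (signPattern-↑ʳ m w r))
           (signPattern-sign m (w ∘ suc) (Finₚ.suc-injective ∘ w-inj) r))
  where
  zero≢suc : ∀ {i} → zero ≢ suc {m} i
  zero≢suc ()

Amᵀ-·ℤ-signPattern : ∀ m (w : Fin m → ℕ) c →
  ((Am m ᵀ) ·ℤ signPattern m w) c ≡ sumℤ (λ c′ → sgn (w c) (w c′))
Amᵀ-·ℤ-signPattern (ℕ.suc m) w zero = begin
  ((Am (ℕ.suc m) ᵀ) ·ℤ signPattern (ℕ.suc m) w) zero
    ≡⟨ Amᵀ-·ℤ-zero m (signPattern (ℕ.suc m) w) ⟩
  sumℤ (λ i → signPattern (ℕ.suc m) w (i ↑ˡ s m))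
    ≡⟨ sumℤ-cong (signPattern-↑ˡ m w) ⟩
  sumℤ (λ i → sgn (w zero) (w (suc i)))
    ≡⟨ sym (trans (cong (λ t → t + sumℤ (λ i → sgn (w zero) (w (suc i)))) (sgn-refl (w zero)))
                  (ℤₚ.+-identityˡ _)) ⟩
  sumℤ (λ c′ → sgn (w zero) (w c′)) ∎
  where open ≡-Reasoning
Amᵀ-·ℤ-signPattern (ℕ.suc m) w (suc j) = begin
  ((Am (ℕ.suc m) ᵀ) ·ℤ signPattern (ℕ.suc m) w) (suc j)
    ≡⟨ Amᵀ-·ℤ-suc m (signPattern (ℕ.suc m) w) j ⟩
  - signPattern (ℕ.suc m) w (j ↑ˡ s m) + ((Am m ᵀ) ·ℤ (signPattern (ℕ.suc m) w ∘ (m ↑ʳ_))) j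
    ≡⟨ cong₂ _+_ (trans (cong -_ (signPattern-↑ˡ m w j)) (neg-sgn (w zero) (w (suc j))))
                 (·ℤ-congʳ (Am m ᵀ) (signPattern-↑ʳ m w) j) ⟩
  sgn (w (suc j)) (w zero) + ((Am m ᵀ) ·ℤ signPattern m (w ∘ suc)) j
    ≡⟨ cong (λ t → sgn (w (suc j)) (w zero) + t) (Amᵀ-·ℤ-signPattern m (w ∘ suc) j) ⟩
  sumℤ (λ c′ → sgn (w (suc j)) (w c′)) ∎
  where open ≡-Reasoning

-- The block-diagonal matrix A

combine-elim : ∀ m k (P : Fin (m ℕ.* k) → Set) → (∀ b r → P (combine b r)) → ∀ i → P i
combine-elim m k P h i =
  subst P (Finₚ.combine-remQuot {m} k i) (h (proj₁ (remQuot {m} k i)) (proj₂ (remQuot {m} k i)))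

sumℤ-if : ∀ {m} (d : Bool) (h v : Vecℤ m) →
  sumℤ (λ c → (if d then h c else 0ℤ) * v c) ≡ (if d then sumℤ (λ c → h c * v c) else 0ℤ)
sumℤ-if         true  h v = refl
sumℤ-if {m = m} false h v = trans (sumℤ-cong (λ c → ℤₚ.*-zeroˡ (v c))) (sumℤ-zero m)

quotRem-combine : ∀ {m k} (i : Fin m) (j : Fin k) → Fin.quotRem {m} k (combine i j) ≡ (j , i)
quotRem-combine i j = cong swap (Finₚ.remQuot-combine i j)

module _ (n : ℕ) where

  Ablk-combine : ∀ b r b′ c →
    Ablk n (combine b r) (combine b′ c) ≡ (if does (b Fin.≟ b′) then Am n r c else 0ℤ)
  Ablk-combine b r b′ c rewrite quotRem-combine {n} {s n} b r | quotRem-combine {n} {n} b′ c = refl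

  Ablk-·ℤ-combine : ∀ (V : Vecℤ (n ℕ.* n)) b r →
    (Ablk n ·ℤ V) (combine b r) ≡ (Am n ·ℤ (V ∘ combine b)) r
  Ablk-·ℤ-combine V b r = begin
    (Ablk n ·ℤ V) (combine b r)
      ≡⟨ sumℤ-combine n {n} (λ col → Ablk n (combine b r) col * V col) ⟩
    sumℤ (λ (b′ : Fin n) → sumℤ (λ (c : Fin n) → Ablk n (combine b r) (combine b′ c) * V (combine b′ c)))
      ≡⟨ sumℤ-cong (λ b′ → trans (sumℤ-cong (λ c → cong (_* V (combine b′ c)) (Ablk-combine b r b′ c)))
                                  (sumℤ-if (does (b Fin.≟ b′)) (Am n r) (V ∘ combine b′))) ⟩
    sumℤ (λ (b′ : Fin n) → if does (b Fin.≟ b′) then (Am n ·ℤ (V ∘ combine b′)) r else 0ℤ)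
      ≡⟨ sumℤ-if-≟ b (λ b′ → (Am n ·ℤ (V ∘ combine b′)) r) ⟩
    (Am n ·ℤ (V ∘ combine b)) r ∎
    where open ≡-Reasoning

  Ablkᵀ-·ℤ-combine : ∀ (l : Vecℤ (n ℕ.* s n)) b c →
    ((Ablk n ᵀ) ·ℤ l) (combine b c) ≡ ((Am n ᵀ) ·ℤ (l ∘ combine b)) c
  Ablkᵀ-·ℤ-combine l b c = begin
    ((Ablk n ᵀ) ·ℤ l) (combine b c)
      ≡⟨ sumℤ-combine n {s n} (λ row → Ablk n row (combine b c) * l row) ⟩
    sumℤ (λ (b′ : Fin n) → sumℤ (λ (r : Fin (s n)) → Ablk n (combine b′ r) (combine b c) * l (combine b′ r)))
      ≡⟨ sumℤ-cong (λ b′ → trans (sumℤ-cong (λ r → cong (_* l (combine b′ r)) (block-sym b′ r)))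
                                  (sumℤ-if (does (b Fin.≟ b′)) (λ r → Am n r c) (l ∘ combine b′))) ⟩
    sumℤ (λ (b′ : Fin n) → if does (b Fin.≟ b′) then ((Am n ᵀ) ·ℤ (l ∘ combine b′)) c else 0ℤ)
      ≡⟨ sumℤ-if-≟ b (λ b′ → ((Am n ᵀ) ·ℤ (l ∘ combine b′)) c) ⟩
    ((Am n ᵀ) ·ℤ (l ∘ combine b)) c ∎
    where
    open ≡-Reasoning
    block-sym : ∀ b′ r →
      Ablk n (combine b′ r) (combine b c) ≡ (if does (b Fin.≟ b′) then Am n r c else 0ℤ)
    block-sym b′ r = trans (Ablk-combine b′ r b c) (cong (λ d → if d then Am n r c else 0ℤ) (≟-sym b′ b))

  Aπ-·ℤ : ∀ (π : Permutation′ (n ℕ.* n)) x → Aπ n π ·ℤ x ≗ Ablk n ·ℤ (x ∘ (π ⟨$⟩ʳ_))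
  Aπ-·ℤ π x row = trans (sumℤ-permute (λ j → Ablk n row (π ⟨$⟩ˡ j) * x j) π)
    (sumℤ-cong (λ col → cong (λ c → Ablk n row c * x (π ⟨$⟩ʳ col)) (Perm.inverseˡ π)))

  Aπ-·ℤ-const : ∀ (π : Permutation′ (n ℕ.* n)) a row → (Aπ n π ·ℤ (λ _ → a)) row ≡ 0ℤ
  Aπ-·ℤ-const π a = combine-elim n (s n) (λ row → (Aπ n π ·ℤ (λ _ → a)) row ≡ 0ℤ)
    (λ b r → trans (Aπ-·ℤ π (λ _ → a) (combine b r))
                   (trans (Ablk-·ℤ-combine (λ _ → a) b r) (Am-·ℤ-const n a r)))

  Aπ-·ℤ-nonzero⇒injective : ∀ (π : Permutation′ (n ℕ.* n)) x → (Aπ n π ·ℤ x) <>0ℤ →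
    ∀ b → Injective _≡_ _≡_ (λ c → x (π ⟨$⟩ʳ combine b c))
  Aπ-·ℤ-nonzero⇒injective π x nonzero b = Am-·ℤ-nonzero⇒injective n (λ c → x (π ⟨$⟩ʳ combine b c))
    (λ r → nonzero (combine b r) ∘ trans (trans (Aπ-·ℤ π x (combine b r)) (Ablk-·ℤ-combine _ b r)))

fin-injective : ∀ {a b} → fin a ≡ fin b → a ≡ b
fin-injective refl = refl

sum∞-fin : ∀ {m} (f : Vecℤ m) → sum∞ (fin ∘ f) ≡ fin (sumℤ f)
sum∞-fin {ℕ.zero}  f = refl
sum∞-fin {ℕ.suc m} f rewrite sum∞-fin (f ∘ suc) = refl

·∞v-fin : ∀ {r c} (M : Mat r c) (x : Vecℤ c) i → (M ·∞v (fin ∘ x)) i ≡ fin ((M ·ℤ x) i)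
·∞v-fin M x i = sum∞-fin (λ j → M i j * x j)

sum∞-cong : ∀ {m} {f h : Fin m → ℤ∞} → f ≗ h → sum∞ f ≡ sum∞ h
sum∞-cong {ℕ.zero}  f≗h = refl
sum∞-cong {ℕ.suc m} f≗h = cong₂ _+∞_ (f≗h zero) (sum∞-cong (f≗h ∘ suc))

·∞v-congʳ : ∀ {r c} (M : Mat r c) {x y : Fin c → ℤ∞} → x ≗ y → M ·∞v x ≗ M ·∞v y
·∞v-congʳ M x≗y i = sum∞-cong (λ j → cong (M i j ·∞_) (x≗y j))

isInf-false : ∀ z → z ≢ ∞ → isInf z ≡ false
isInf-false (fin _) _   = refl
isInf-false ∞       z≢∞ = ⊥-elim (z≢∞ refl)

count-≤ : ∀ {m} (p : Fin m → Bool) → count p ℕ.≤ m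
count-≤ {ℕ.zero}  p = ℕ.z≤n
count-≤ {ℕ.suc m} p with p zero
... | true  = ℕ.s≤s (count-≤ (p ∘ suc))
... | false = ℕₚ.m≤n⇒m≤1+n (count-≤ (p ∘ suc))

count-true : ∀ {m} (p : Fin m → Bool) → (∀ i → p i ≡ true) → count p ≡ m
count-true {ℕ.zero}  p all = refl
count-true {ℕ.suc m} p all rewrite all zero = cong ℕ.suc (count-true (p ∘ suc) (all ∘ suc))

count-false : ∀ {m} (p : Fin m → Bool) → (∀ i → p i ≡ false) → count p ≡ 0
count-false {ℕ.zero}  p none = refl
count-false {ℕ.suc m} p none rewrite none zero = count-false (p ∘ suc) (none ∘ suc)

count≡0⇒false : ∀ {m} (p : Fin m → Bool) → count p ≡ 0 → ∀ i → p i ≡ false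
count≡0⇒false {ℕ.suc m} p count≡0 i with p zero in p₀
count≡0⇒false {ℕ.suc m} p ()      i       | true
count≡0⇒false {ℕ.suc m} p count≡0 zero    | false = p₀
count≡0⇒false {ℕ.suc m} p count≡0 (suc i) | false = count≡0⇒false (p ∘ suc) count≡0 i

rank-bounds : ∀ {m} (c : Fin m) → + 1 ℤ.≤ rank c × rank c ℤ.≤ + m
rank-bounds c = ℤ.+≤+ (ℕ.s≤s ℕ.z≤n) , ℤ.+≤+ (Finₚ.toℕ<n c)

bounded⇒rank : ∀ m z → + 1 ℤ.≤ z → z ℤ.≤ + m → ∃ λ (c : Fin m) → z ≡ rank c
bounded⇒rank m (+ ℕ.zero)  (ℤ.+≤+ ()) _
bounded⇒rank m (+ ℕ.suc t) _ (ℤ.+≤+ t<m) =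
  Fin.fromℕ< t<m , cong (λ u → + ℕ.suc u) (sym (Finₚ.toℕ-fromℕ< t<m))

double-≡0 : ∀ {a} → + 2 * a ≡ 0ℤ → a ≡ 0ℤ
double-≡0 2a≡0 with ℤₚ.i*j≡0⇒i≡0∨j≡0 (+ 2) 2a≡0
... | inj₂ a≡0 = a≡0

double-minus-injective : ∀ {a b c} → + 2 * a - c ≡ + 2 * b - c → a ≡ b
double-minus-injective {a} {b} {c} eq =
  ℤₚ.*-cancelˡ-≡ (+ 2) a b (+-cancelʳ (- c) (+ 2 * a) (+ 2 * b) eq)

-- Pairing dual sign vectors with ∞-free primal points

module Duality (n : ℕ) (π₁ π₂ π₃ : Permutation′ (n ℕ.* n))
               (k : ℕ) (idx : Fin k → Fin (n ℕ.* n)) (g : Fin k → ℤ) where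

  open Problem n π₁ π₂ π₃ k idx g

  Paired : Vecℤ (n ℕ.* s n) → Vecℤ N → Set
  Paired λ′ x = ∀ j → ((Aπ n π₁ ᵀ) ·ℤ λ′) j ≡ + 2 * x j - + ℕ.suc n

  Ar-·ℤ-const : ∀ r i → (Ar r ·ℤ (λ _ → 1ℤ)) i ≡ 0ℤ
  Ar-·ℤ-const zero             = Aπ-·ℤ-const n π₁ 1ℤ
  Ar-·ℤ-const (suc zero)       = Aπ-·ℤ-const n π₂ 1ℤ
  Ar-·ℤ-const (suc (suc zero)) = Aπ-·ℤ-const n π₃ 1ℤ

  Paired-Ar : ∀ {λ′ x} → Paired λ′ x →
    ∀ r i → ((Ar r ⊗ (Aπ n π₁ ᵀ)) ·ℤ λ′) i ≡ + 2 * (Ar r ·ℤ x) i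
  Paired-Ar {λ′} {x} paired r i = begin
    ((Ar r ⊗ (Aπ n π₁ ᵀ)) ·ℤ λ′) i
      ≡⟨ ⊗-·ℤ-assoc (Ar r) (Aπ n π₁ ᵀ) λ′ i ⟩
    (Ar r ·ℤ ((Aπ n π₁ ᵀ) ·ℤ λ′)) i
      ≡⟨ ·ℤ-congʳ (Ar r) paired i ⟩
    (Ar r ·ℤ (λ j → + 2 * x j - + ℕ.suc n)) i
      ≡⟨ ·ℤ-affine-balanced (Ar r) (+ 2) _ x i (Ar-·ℤ-const r i) ⟩
    + 2 * (Ar r ·ℤ x) i ∎
    where open ≡-Reasoning

  Paired-eqDual : ∀ {λ′ x} → Paired λ′ x → ∀ l → eqDual λ′ l ≡ + 2 * x (idx l) - + ℕ.suc n
  Paired-eqDual {λ′} paired l = trans (⊗-·ℤ-assoc (Aeq idx) (Aπ n π₁ ᵀ) λ′ l)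
    (trans (sumℤ-δ (idx l) ((Aπ n π₁ ᵀ) ·ℤ λ′)) (paired (idx l)))

  signs⇒Paired : ∀ λ′ → (∀ r → Sign (λ′ r)) → ∃ λ (a : Fin N → Fin n) → Paired λ′ (rank ∘ a)
  signs⇒Paired λ′ signs = (proj₁ ∘ column ∘ (π₁ ⟨$⟩ˡ_)) , (proj₂ ∘ column ∘ (π₁ ⟨$⟩ˡ_))
    where
    column : ∀ col → ∃ λ (t : Fin n) → ((Ablk n ᵀ) ·ℤ λ′) col ≡ + 2 * rank t - + ℕ.suc n
    column = combine-elim n n _ λ b c →
      let t , col≡ = Amᵀ-·ℤ-signs n (λ′ ∘ combine b) (signs ∘ combine b) c
      in  t , trans (Ablkᵀ-·ℤ-combine n λ′ b c) col≡

  nonzero⇒Paired : ∀ (a : Fin N → Fin n) → (Aπ n π₁ ·ℤ (rank ∘ a)) <>0ℤ →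
    ∃ λ λ′ → (∀ r → Sign (λ′ r)) × Paired λ′ (rank ∘ a)
  nonzero⇒Paired a nonzero = λ′ , signs , paired
    where
    block : Fin n → Fin n → Fin n
    block b c = a (π₁ ⟨$⟩ʳ combine b c)

    block-injective : ∀ b → Injective _≡_ _≡_ (block b)
    block-injective b = Aπ-·ℤ-nonzero⇒injective n π₁ (rank ∘ a) nonzero b ∘ cong rank

    λ′ : Vecℤ (n ℕ.* s n)
    λ′ row = let b , r = remQuot {n} (s n) row in signPattern n (toℕ ∘ block b) r

    signs : ∀ r → Sign (λ′ r)
    signs row = let b , r = remQuot {n} (s n) row in
      signPattern-sign n (toℕ ∘ block b) (block-injective b ∘ Finₚ.toℕ-injective) r

    column : ∀ col → ((Ablk n ᵀ) ·ℤ λ′) col ≡ + 2 * rank (a (π₁ ⟨$⟩ʳ col)) - + ℕ.suc n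
    column = combine-elim n n _ λ b c → begin
      ((Ablk n ᵀ) ·ℤ λ′) (combine b c)
        ≡⟨ Ablkᵀ-·ℤ-combine n λ′ b c ⟩
      ((Am n ᵀ) ·ℤ (λ′ ∘ combine b)) c
        ≡⟨ ·ℤ-congʳ (Am n ᵀ) (λ r → cong (λ (b , r) → signPattern n (toℕ ∘ block b) r)
                                         (Finₚ.remQuot-combine b r)) c ⟩
      ((Am n ᵀ) ·ℤ signPattern n (toℕ ∘ block b)) c
        ≡⟨ Amᵀ-·ℤ-signPattern n (toℕ ∘ block b) c ⟩
      sumℤ (λ c′ → sgn (toℕ (block b c)) (toℕ (block b c′)))
        ≡⟨ sumℤ-sgn-permutation (block b) (block-injective b) c ⟩
      + 2 * rank (block b c) - + ℕ.suc n ∎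
      where open ≡-Reasoning

    paired : Paired λ′ (rank ∘ a)
    paired j =
      trans (column (π₁ ⟨$⟩ˡ j)) (cong (λ i → + 2 * rank (a i) - + ℕ.suc n) (Perm.inverseʳ π₁))

  finite : (Fin N → Fin n) → Fin N → ℤ∞
  finite a = fin ∘ rank ∘ a

  FullDual : Vecℤ (n ℕ.* s n) → Set
  FullDual λ′ = InFD λ′ × (∀ l → eqDual λ′ l ≡ rhs l)

  FinitePrimal : (Fin N → ℤ∞) → Set
  FinitePrimal x = InFP x × (∀ i → x i ≢ ∞)

  Paired⇒FullDual⇔InFP : ∀ {λ′} a → (∀ r → Sign (λ′ r)) → Paired λ′ (rank ∘ a) →
    FullDual λ′ ⇔ InFP (finite a)
  Paired⇒FullDual⇔InFP {λ′} a signs paired = mk⇔ toPrimal toDual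
    where
    x : Vecℤ N
    x = rank ∘ a

    dual-Ar : ∀ r i → ((Ar r ⊗ (Aπ n π₁ ᵀ)) ·ℤ λ′) i ≡ + 2 * (Ar r ·ℤ x) i
    dual-Ar = Paired-Ar {λ′} {x} paired

    dual-eq : ∀ l → eqDual λ′ l ≡ + 2 * x (idx l) - + ℕ.suc n
    dual-eq = Paired-eqDual {λ′} {x} paired

    primal-eq : ∀ l → (Aeq idx ·∞v finite a) l ≡ fin (x (idx l))
    primal-eq l = trans (·∞v-fin (Aeq idx) x l) (cong fin (sumℤ-δ (idx l) x))

    toPrimal : FullDual λ′ → InFP (finite a)
    toPrimal ((_ , nonzero) , solves) =
      (λ i → inj₁ (x i , refl , rank-bounds (a i))) ,
      (λ r i A·x≡0 → nonzero r i (trans (dual-Ar r i)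
        (trans (cong (+ 2 *_) (fin-injective (trans (sym (·∞v-fin (Ar r) x i)) A·x≡0)))
               (ℤₚ.*-zeroʳ (+ 2))))) ,
      (λ l → trans (primal-eq l) (cong fin (double-minus-injective (trans (sym (dual-eq l)) (solves l)))))

    toDual : InFP (finite a) → FullDual λ′
    toDual (_ , nonzero , solves) =
      (signs , λ r i A·λ′≡0 → nonzero r i (trans (·∞v-fin (Ar r) x i)
                                 (cong fin (double-≡0 (trans (sym (dual-Ar r i)) A·λ′≡0))))) ,
      (λ l → trans (dual-eq l)
               (cong (λ z → + 2 * z - + ℕ.suc n) (fin-injective (trans (sym (primal-eq l)) (solves l)))))

  finite-view : ∀ {x} → InFP x → (∀ i → x i ≢ ∞) → ∃ λ a → x ≗ finite a
  finite-view {x} (bounded , _) finite-x = proj₁ ∘ entry , proj₂ ∘ entry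
    where
    entry : ∀ i → ∃ λ (c : Fin n) → x i ≡ fin (rank c)
    entry i with bounded i
    ... | inj₂ x≡∞ = ⊥-elim (finite-x i x≡∞)
    ... | inj₁ (z , x≡z , lo , hi) = let c , z≡c = bounded⇒rank n z lo hi in c , trans x≡z (cong fin z≡c)

  FinitePrimal⇒InFP-finite : ∀ {x} → FinitePrimal x → ∃ λ a → InFP (finite a)
  FinitePrimal⇒InFP-finite (inFP@(_ , nonzero , solves) , finite-x) =
    let a , x≗a = finite-view inFP finite-x in
    a , (λ i → inj₁ (rank (a i) , refl , rank-bounds (a i))) ,
        (λ r i → nonzero r i ∘ trans (·∞v-congʳ (Ar r) x≗a i)) ,
        (λ l → trans (sym (·∞v-congʳ (Aeq idx) x≗a l)) (solves l))

  FinitePrimal⇒FullDual : ∀ {x} → FinitePrimal x → ∃ FullDual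
  FinitePrimal⇒FullDual finitePrimal =
    let a , inFP = FinitePrimal⇒InFP-finite finitePrimal
        λ′ , signs , paired = nonzero⇒Paired a λ i A·x≡0 →
          proj₁ (proj₂ inFP) zero i (trans (·∞v-fin (Ar zero) (rank ∘ a) i) (cong fin A·x≡0))
    in  λ′ , Equivalence.from (Paired⇒FullDual⇔InFP a signs paired) inFP

  FullDual⇒FinitePrimal : ∀ {λ′} → FullDual λ′ → ∃ FinitePrimal
  FullDual⇒FinitePrimal {λ′} fullDual@((signs , _) , _) =
    let a , paired = signs⇒Paired λ′ signs
    in  finite a , Equivalence.to (Paired⇒FullDual⇔InFP a signs paired) fullDual , λ i ()

  fD≤0 : ∀ λ′ → fD λ′ ℤ.≤ 0ℤ
  fD≤0 λ′ = ℤₚ.i≤j⇒i-j≤0 (ℤ.+≤+ (count-≤ (λ l → does (eqDual λ′ l ℤ.≟ rhs l))))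

  solves⇒fD≡0 : ∀ {λ′} → (∀ l → eqDual λ′ l ≡ rhs l) → fD λ′ ≡ 0ℤ
  solves⇒fD≡0 {λ′} solves = trans
    (cong (λ c → + c - + k) (count-true _ (λ l → dec-true (eqDual λ′ l ℤ.≟ rhs l) (solves l))))
    (ℤₚ.+-inverseʳ (+ k))

  finite⇒fP≡0 : ∀ {x} → (∀ i → x i ≢ ∞) → fP x ≡ 0
  finite⇒fP≡0 {x} finite-x = count-false _ (λ i → isInf-false (x i) (finite-x i))

  fP≡0⇒finite : ∀ {x} → fP x ≡ 0 → ∀ i → x i ≢ ∞
  fP≡0⇒finite {x} fP≡0 i x≡∞
    with trans (sym (cong isInf x≡∞)) (count≡0⇒false (isInf ∘ x) fP≡0 i)
  ... | ()

  vD≤0 : ∀ {vD} → IsVD vD → vD ℤ.≤ 0ℤ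
  vD≤0 ((λ′ , _ , fD≡vD) , _) = subst (ℤ._≤ 0ℤ) fD≡vD (fD≤0 λ′)

  FullDual⇒vD≡0 : ∀ {vD} → IsVD vD → ∃ FullDual → vD ≡ 0ℤ
  FullDual⇒vD≡0 isVD (λ′ , inFD , solves) =
    ℤₚ.≤-antisym (vD≤0 isVD) (subst (ℤ._≤ _) (solves⇒fD≡0 solves) (proj₂ isVD λ′ inFD))

  FinitePrimal⇒vP≡0 : ∀ {vP} → IsVP vP → ∃ FinitePrimal → vP ≡ 0
  FinitePrimal⇒vP≡0 {vP} (_ , minimal) (x , inFP , finite-x) =
    ℕₚ.n≤0⇒n≡0 (subst (vP ℕ.≤_) (finite⇒fP≡0 finite-x) (minimal x inFP))

theorem5p3 : (n : ℕ) → 2 ≤ n →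
  (π₁ π₂ π₃ : Permutation′ (n Data.Nat.* n)) →
  (k : ℕ) (idx : Fin k → Fin (n Data.Nat.* n)) → Injective _≡_ _≡_ idx →
  (g : Fin k → ℤ) → (∀ l → (+ 1 Data.Integer.≤ g l) × (g l Data.Integer.≤ + n)) →
  let open Problem n π₁ π₂ π₃ k idx g in
  ∃ InFP → ∃ InFD →
  (vP : ℕ) → IsVP vP → (vD : ℤ) → IsVD vD →
  ((+ vP ≡ vD) ⇔ (∃ λ x → SolvesPP vP x × (∀ i → x i ≢ ∞)))
  × ((∃ λ x → SolvesPP vP x × (∀ i → x i ≢ ∞))
     ⇔ (∃ λ λ′ → SolvesDP vD λ′ × (∀ l → eqDual λ′ l ≡ rhs l)))
theorem5p3 n _ π₁ π₂ π₃ k idx _ g _ _ _ vP isVP@((x* , x*∈FP , fPx*≡vP) , _) vD isVD =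
  mk⇔ i⇒ii ii⇒i , mk⇔ ii⇒iii iii⇒ii
  where
  open Problem n π₁ π₂ π₃ k idx g
  open Duality n π₁ π₂ π₃ k idx g

  II III : Set
  II  = ∃ λ x → SolvesPP vP x × (∀ i → x i ≢ ∞)
  III = ∃ λ λ′ → SolvesDP vD λ′ × (∀ l → eqDual λ′ l ≡ rhs l)

  i⇒ii : + vP ≡ vD → II
  i⇒ii vP≡vD = x* , (x*∈FP , fPx*≡vP) , fP≡0⇒finite (trans fPx*≡vP vP≡0)
    where
    vP≡0 : vP ≡ 0
    vP≡0 = ℕₚ.n≤0⇒n≡0 (ℤₚ.drop‿+≤+ (subst (ℤ._≤ 0ℤ) (sym vP≡vD) (vD≤0 isVD)))

  ii⇒i : II → + vP ≡ vD
  ii⇒i (x , (inFP , fP≡vP) , finite-x) = begin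
    + vP    ≡⟨ cong +_ (trans (sym fP≡vP) (finite⇒fP≡0 finite-x)) ⟩
    0ℤ      ≡⟨ sym (FullDual⇒vD≡0 isVD (FinitePrimal⇒FullDual (inFP , finite-x))) ⟩
    vD      ∎
    where open ≡-Reasoning

  ii⇒iii : II → III
  ii⇒iii (x , (inFP , _) , finite-x) =
    let λ′ , full@(inFD , solves) = FinitePrimal⇒FullDual (inFP , finite-x)
    in  λ′ , (inFD , trans (solves⇒fD≡0 solves) (sym (FullDual⇒vD≡0 isVD (λ′ , full)))) , solves

  iii⇒ii : III → II
  iii⇒ii (λ′ , (inFD , _) , solves) =
    let x , finitePrimal@(inFP , finite-x) = FullDual⇒FinitePrimal (inFD , solves)
        fP≡vP = trans (finite⇒fP≡0 finite-x) (sym (FinitePrimal⇒vP≡0 isVP (x , finitePrimal)))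
    in  x , (inFP , fP≡vP) , finite-x
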